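{- Let $p$ be an odd prime and let $c\in GF(p)\setminus\{0\}$ be a nonsquare if $p\equiv 1 \pmod 4$ and a nonzero square if $p\equiv 3\pmod 4$. For $k\in GF(p)\setminus\{0\}$ let $O_k\subset PG(2,p)$ be the conic $x^2+ky^2+ckz^2=0$. For nonzero $\alpha,\beta$ (indices computed in $GF(p)$) we have $O_\alpha\diamond O_\beta$ if and only if $O_\beta\diamond O_{\beta^2\alpha^{ -1}}$.
   Context: $PG(2,p)$ is the projective plane over $GF(p)$ with homogeneous coordinates. A point $P$ is an exterior point of a conic $O$ if exactly two tangents of $O$ (lines meeting $O$ in exactly one point) pass through $P$. For conics $O,O'$, $O\diamond O'$ means every point of $O'$ is an exterior point of $O$. -}

module Defs where

open import Data.Nat using (ℕ; _+_; _*_; _<_; NonZero; _≟_)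
open import Data.Nat.DivMod using (_%_)
open import Data.Nat.Divisibility using (_∣_; _∣?_)
open import Data.Product using (_×_; _,_; ∃)
open import Data.List using (List; []; _∷_; map; filter; upTo; cartesianProduct; length; _++_)
open import Data.List.Membership.Propositional using (_∈_)
open import Relation.Binary.PropositionalEquality using (_≡_)
open import Relation.Nullary using (¬_; Dec)
open import Relation.Nullary.Decidable using (_×-dec_)

-- Elements of GF(p) are represented by naturals 0..p-1; arithmetic is taken mod p.
-- Homogeneous triples over GF(p).
Triple : Set
Triple = ℕ × ℕ × ℕ

-- Canonical (normalised) representatives of the points of PG(2,p):
-- first nonzero coordinate equal to 1.  Each point of PG(2,p) appears exactly once.
-- Lines of PG(2,p) are represented the same way (dual coordinates [a,b,c]).
normTriples : ℕ → List Triple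
normTriples p =
  map (λ yz → (1 , yz)) (cartesianProduct (upTo p) (upTo p))
  ++ map (λ z → (0 , 1 , z)) (upTo p)
  ++ (0 , 0 , 1) ∷ []

Points : ℕ → List Triple
Points = normTriples

Lines : ℕ → List Triple
Lines = normTriples

Incident : ℕ → Triple → Triple → Set
Incident p (a , b , c) (x , y , z) = p ∣ (a * x + b * y + c * z)

OnConic : ℕ → ℕ → ℕ → Triple → Set
OnConic p c k (x , y , z) = p ∣ (x * x + k * y * y + c * k * z * z)

Incident? : ∀ p L P → Dec (Incident p L P)
Incident? p (a , b , c) (x , y , z) = p ∣? (a * x + b * y + c * z)

OnConic? : ∀ p c k P → Dec (OnConic p c k P)
OnConic? p c k (x , y , z) = p ∣? (x * x + k * y * y + c * k * z * z)

conicPointsOn : ℕ → ℕ → ℕ → Triple → List Triple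
conicPointsOn p c k L =
  filter (λ P → Incident? p L P ×-dec OnConic? p c k P) (Points p)

Tangent : ℕ → ℕ → ℕ → Triple → Set
Tangent p c k L = length (conicPointsOn p c k L) ≡ 1

Tangent? : ∀ p c k L → Dec (Tangent p c k L)
Tangent? p c k L = length (conicPointsOn p c k L) ≟ 1

tangentsThrough : ℕ → ℕ → ℕ → Triple → List Triple
tangentsThrough p c k P =
  filter (λ L → Incident? p L P ×-dec Tangent? p c k L) (Lines p)

Exterior : ℕ → ℕ → ℕ → Triple → Set
Exterior p c k P = length (tangentsThrough p c k P) ≡ 2

Diamond : ℕ → ℕ → ℕ → ℕ → Set
Diamond p c k k' = ∀ P → P ∈ Points p → OnConic p c k' P → Exterior p c k P

IsSquare : (p : ℕ) .{{_ : NonZero p}} → ℕ → Set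
IsSquare p a = ∃ λ x → x < p × (x * x) % p ≡ a % p

module Submission where

-- For a, b ∈ GF(p) the matrix R = diag(1, [[a, −cb], [b, a]]) (multiplication by a + b√−c
-- on the last two coordinates) satisfies Q_k(R v) = Q_{kr}(v) for every k, where r = a² + c b²
-- = det R.  When r ≠ 0, R is a collineation of PG(2,p) carrying O_{kr} onto O_k for all k at once;
-- collineations preserve tangents (counted through the transpose acting on lines) and exterior
-- points, hence O_k ⋄ O_l ⇒ O_{kr} ⋄ O_{lr}.  The norm form a² + c b² takes every value of GF(p)
-- (pigeonhole on the p + 1 values i² and t − c j²), so r = β/α proves "⇒" and r = α/β proves "⇐".

open import Defs
open import Data.Empty using (⊥-elim)
open import Data.Fin using (Fin; toℕ; fromℕ<)
open import Data.Fin.Properties using (pigeonhole; toℕ-fromℕ<; toℕ<n)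
open import Data.Integer as Int using (ℤ; +_; _%ℕ_; _/ℕ_)
import Data.Integer.Properties as IntP
open import Data.Integer.DivMod using (a≡a%ℕn+[a/ℕn]*n; n%ℕd<d)
open import Data.Integer.Divisibility.Signed as Signed using (divides) renaming (_∣_ to _∣ℤ_)
open import Data.Integer.Tactic.RingSolver using (solve-∀)
open import Data.List using (List; []; _∷_; map; filter; length; _++_; upTo; cartesianProduct)
open import Data.List.Properties using (length-map)
open import Data.List.Membership.Propositional using (_∈_)
open import Data.List.Membership.Propositional.Properties
  using (∈-++⁺ˡ; ∈-++⁺ʳ; ∈-++⁻; ∈-map⁺; ∈-map⁻; ∈-cartesianProduct⁺; ∈-cartesianProduct⁻; ∈-upTo⁺; ∈-upTo⁻; ∈-filter⁺; ∈-filter⁻)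
open import Data.List.Relation.Unary.Any using (here; there)
import Data.List.Relation.Unary.All as All
open import Data.List.Relation.Unary.AllPairs using ([]; _∷_)
open import Data.List.Relation.Unary.Unique.Propositional using (Unique)
import Data.List.Relation.Unary.Unique.Propositional.Properties as Unique
open import Data.Nat as Nat using (ℕ; suc; _<_; _≤_; _∸_; _≤?_; z≤n; s≤s; NonZero)
import Data.Nat.Properties as NatP
import Data.Nat.Divisibility as NatD
import Data.Nat.DivMod as NatDM
open import Data.Nat.DivMod using (_%_)
open import Data.Nat.Coprimality using (prime⇒coprime; coprime-Bézout)
open import Data.Nat.GCD using (module Bézout)
open import Data.Nat.Primality using (Prime; euclidsLemma; ¬prime[1]; prime⇒nonZero)
open import Data.Product using (_×_; _,_; ∃; ∃₂; proj₁; proj₂)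
open import Data.Product.Function.NonDependent.Propositional using (_×-⇔_)
open import Data.Sum using (_⊎_; inj₁; inj₂)
open import Function.Bundles using (_⇔_; mk⇔; Equivalence)
import Function.Properties.Equivalence as ⇔
open import Level using (0ℓ)
open import Relation.Binary.Bundles using (Setoid)
open import Relation.Binary.Definitions using (tri<; tri≈; tri>)
import Relation.Binary.Reasoning.Setoid as SetoidReasoning
open import Relation.Binary.PropositionalEquality
  using (_≡_; _≢_; refl; sym; trans; cong; cong₂; subst; module ≡-Reasoning)
open import Relation.Nullary using (¬_; Dec; yes; no)
import Relation.Nullary.Decidable as Dec
open import Relation.Nullary.Decidable using (_×-dec_)
open import Relation.Unary using (Pred; Decidable)

module Counting {A : Set} where

  remove : ∀ {x : A} (ys : List A) → x ∈ ys → List A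
  remove (_ ∷ ys) (here _)  = ys
  remove (y ∷ ys) (there m) = y ∷ remove ys m

  length-remove : ∀ {x} ys (m : x ∈ ys) → length ys ≡ suc (length (remove ys m))
  length-remove (_ ∷ ys) (here _)  = refl
  length-remove (_ ∷ ys) (there m) = cong suc (length-remove ys m)

  ∈-remove : ∀ {x z} ys (m : x ∈ ys) → z ∈ ys → z ≢ x → z ∈ remove ys m
  ∈-remove (_ ∷ ys) (here refl) (here refl) z≢x = ⊥-elim (z≢x refl)
  ∈-remove (_ ∷ ys) (here _)    (there z∈)  _   = z∈
  ∈-remove (_ ∷ ys) (there m)   (here refl) _   = here refl
  ∈-remove (_ ∷ ys) (there m)   (there z∈)  z≢x = there (∈-remove ys m z∈ z≢x)

  unique-⊆⇒length-≤ : ∀ xs ys → Unique xs → (∀ {z} → z ∈ xs → z ∈ ys) → length xs ≤ length ys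
  unique-⊆⇒length-≤ []       ys _           _  = z≤n
  unique-⊆⇒length-≤ (x ∷ xs) ys (x∉xs ∷ u) xs⊆ys =
    subst (suc (length xs) ≤_) (sym (length-remove ys x∈ys))
      (s≤s (unique-⊆⇒length-≤ xs (remove ys x∈ys) u
        (λ z∈xs → ∈-remove ys x∈ys (xs⊆ys (there z∈xs)) (λ { refl → All.lookup x∉xs z∈xs refl }))))
    where x∈ys = xs⊆ys (here refl)

  count-≤ : ∀ S → Unique S → {E E′ : Pred A 0ℓ} (E? : Decidable E) (E′? : Decidable E′) (k h : A → A) →
    (∀ {x} → x ∈ S → E x → k x ∈ filter E′? S) → (∀ {x} → x ∈ S → h (k x) ≡ x) →
    length (filter E? S) ≤ length (filter E′? S)
  count-≤ S u E? E′? k h k∈ hk =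
    subst (_ ≤_) (length-map h (filter E′? S))
      (unique-⊆⇒length-≤ _ _ (Unique.filter⁺ E? u) λ z∈ →
        let z∈S , Ez = ∈-filter⁻ E? z∈ in subst (_∈ map h _) (hk z∈S) (∈-map⁺ h (k∈ z∈S Ez)))

  count-bijection : ∀ S → Unique S →
    {D₁ D₂ : Pred A 0ℓ} (D₁? : Decidable D₁) (D₂? : Decidable D₂) (f g : A → A) →
    (∀ {x} → x ∈ S → f x ∈ S) → (∀ {x} → x ∈ S → g x ∈ S) →
    (∀ {x} → x ∈ S → g (f x) ≡ x) → (∀ {x} → x ∈ S → f (g x) ≡ x) →
    (∀ {x} → x ∈ S → D₁ x ⇔ D₂ (f x)) →
    length (filter D₁? S) ≡ length (filter D₂? S)
  count-bijection S u {D₁} {D₂} D₁? D₂? f g f∈ g∈ gf fg D₁⇔D₂ = NatP.≤-antisym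
    (count-≤ S u D₁? D₂? f g (λ x∈ d → ∈-filter⁺ D₂? (f∈ x∈) (Equivalence.to (D₁⇔D₂ x∈) d)) gf)
    (count-≤ S u D₂? D₁? g f
      (λ x∈ d → ∈-filter⁺ D₁? (g∈ x∈) (Equivalence.from (D₁⇔D₂ (g∈ x∈)) (subst D₂ (sym (fg x∈)) d))) fg)

module ModularArithmetic (p : ℕ) {{_ : NonZero p}} (prime : Prime p) where
  open Int using (_+_; _*_; -_; _-_)

  infix 4 _≈_ _≉_

  record _≈_ (a b : ℤ) : Set where
    constructor mk≈
    field p∣a-b : + p ∣ℤ a - b
  open _≈_ public

  _≉_ : ℤ → ℤ → Set
  a ≉ b = ¬ (a ≈ b)

  ≈-by : ∀ {a b} x → a - b ≡ x → + p ∣ℤ x → a ≈ b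
  ≈-by x eq p∣x = mk≈ (subst (+ p ∣ℤ_) (sym eq) p∣x)

  multiple⇒≈ : ∀ {a b} q → a ≡ b + q * + p → a ≈ b
  multiple⇒≈ {b = b} q refl = ≈-by (q * + p) (lemma b (q * + p)) (divides q refl)
    where lemma : ∀ b x → b + x - b ≡ x
          lemma = solve-∀

  ≈-refl : ∀ {a} → a ≈ a
  ≈-refl {a} = ≈-by (+ 0) (IntP.+-inverseʳ a) (divides (+ 0) refl)

  ≈-sym : ∀ {a b} → a ≈ b → b ≈ a
  ≈-sym {a} {b} a≈b = ≈-by (- (a - b)) (lemma a b) (Signed.∣m⇒∣-m (p∣a-b a≈b))
    where lemma : ∀ a b → b - a ≡ - (a - b)
          lemma = solve-∀

  ≈-trans : ∀ {a b c} → a ≈ b → b ≈ c → a ≈ c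
  ≈-trans {a} {b} {c} a≈b b≈c = ≈-by (a - b + (b - c)) (lemma a b c) (Signed.∣m∣n⇒∣m+n (p∣a-b a≈b) (p∣a-b b≈c))
    where lemma : ∀ a b c → a - c ≡ a - b + (b - c)
          lemma = solve-∀

  ≡⇒≈ : ∀ {a b} → a ≡ b → a ≈ b
  ≡⇒≈ refl = ≈-refl

  +-cong : ∀ {a b c d} → a ≈ b → c ≈ d → a + c ≈ b + d
  +-cong {a} {b} {c} {d} a≈b c≈d = ≈-by (a - b + (c - d)) (lemma a b c d) (Signed.∣m∣n⇒∣m+n (p∣a-b a≈b) (p∣a-b c≈d))
    where lemma : ∀ a b c d → a + c - (b + d) ≡ a - b + (c - d)
          lemma = solve-∀

  +-congˡ : ∀ a {b c} → b ≈ c → a + b ≈ a + c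
  +-congˡ a = +-cong (≈-refl {a})

  *-cong : ∀ {a b c d} → a ≈ b → c ≈ d → a * c ≈ b * d
  *-cong {a} {b} {c} {d} a≈b c≈d =
    ≈-by ((a - b) * c + b * (c - d)) (lemma a b c d)
      (Signed.∣m∣n⇒∣m+n (Signed.∣m⇒∣m*n c (p∣a-b a≈b)) (Signed.∣n⇒∣m*n b (p∣a-b c≈d)))
    where lemma : ∀ a b c d → a * c - b * d ≡ (a - b) * c + b * (c - d)
          lemma = solve-∀

  *-congˡ : ∀ a {b c} → b ≈ c → a * b ≈ a * c
  *-congˡ a = *-cong (≈-refl {a})

  *-congʳ : ∀ c {a b} → a ≈ b → a * c ≈ b * c
  *-congʳ c a≈b = *-cong a≈b (≈-refl {c})

  −-cancelˡ : ∀ t {x y} → t - x ≈ t - y → x ≈ y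
  −-cancelˡ t {x} {y} tx≈ty = ≈-by (- (t - x - (t - y))) (lemma t x y) (Signed.∣m⇒∣-m (p∣a-b tx≈ty))
    where lemma : ∀ t x y → x - y ≡ - (t - x - (t - y))
          lemma = solve-∀

  ≈-setoid : Setoid 0ℓ 0ℓ
  ≈-setoid = record
    { Carrier = ℤ ; _≈_ = _≈_
    ; isEquivalence = record { refl = ≈-refl ; sym = ≈-sym ; trans = ≈-trans } }

  module ≈-Reasoning = SetoidReasoning ≈-setoid

  residue : ∀ a → a ≈ + (a %ℕ p)
  residue a = multiple⇒≈ (a /ℕ p) (a≡a%ℕn+[a/ℕn]*n a p)

  ≈0⇔∣ : ∀ {a} → a ≈ + 0 ⇔ + p ∣ℤ a
  ≈0⇔∣ {a} = mk⇔ (λ a≈0 → subst (+ p ∣ℤ_) (IntP.+-identityʳ a) (p∣a-b a≈0))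
                 (λ p∣a → mk≈ (subst (+ p ∣ℤ_) (sym (IntP.+-identityʳ a)) p∣a))

  ℕ≈0⇔∣ : ∀ {n} → + n ≈ + 0 ⇔ p NatD.∣ n
  ℕ≈0⇔∣ = mk⇔ (λ h → Signed.∣⇒∣ᵤ (Equivalence.to ≈0⇔∣ h)) (λ h → Equivalence.from ≈0⇔∣ (Signed.∣ᵤ⇒∣ h))

  _≈0? : ∀ a → Dec (a ≈ + 0)
  a ≈0? = Dec.map′ mk≈ p∣a-b (+ p Signed.∣? a - + 0)

  ∤-small : ∀ {d} → 0 < d → d < p → ¬ p NatD.∣ d
  ∤-small 0<d d<p = NatD.>⇒∤ {{Nat.>-nonZero 0<d}} d<p

  small≉0 : ∀ {n} → n ≢ 0 → n < p → + n ≉ + 0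
  small≉0 n≢0 n<p h = ∤-small (NatP.n≢0⇒n>0 n≢0) n<p (Equivalence.to ℕ≈0⇔∣ h)

  1≉0 : + 1 ≉ + 0
  1≉0 h = ¬prime[1] (subst Prime (NatD.∣1⇒≡1 (Equivalence.to ℕ≈0⇔∣ h)) prime)

  -- Distinct residues below p are incongruent: their distance lies strictly between 0 and p.
  <-≉ : ∀ {m n} → m < n → n < p → + m ≉ + n
  <-≉ {m} {n} m<n n<p m≈n =
    ∤-small (NatP.m<n⇒0<n∸m m<n) (NatP.≤-<-trans (NatP.m∸n≤m n m) n<p) (subst (p NatD.∣_) (IntP.∣⊖∣-< m<n) p∣distance)
    where p∣distance : p NatD.∣ Int.∣ m Int.⊖ n ∣
          p∣distance = subst (λ x → p NatD.∣ Int.∣ x ∣) (IntP.m-n≡m⊖n m n) (Signed.∣⇒∣ᵤ (p∣a-b m≈n))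

  ≈-canonical : ∀ {m n} → m < p → n < p → + m ≈ + n → m ≡ n
  ≈-canonical {m} {n} m<p n<p m≈n with NatP.<-cmp m n
  ... | tri< m<n _ _ = ⊥-elim (<-≉ m<n n<p m≈n)
  ... | tri≈ _ m≡n _ = m≡n
  ... | tri> _ _ n<m = ⊥-elim (<-≉ n<m m<p (≈-sym m≈n))

  %-≡⇒≈ : ∀ a b → a %ℕ p ≡ b %ℕ p → a ≈ b
  %-≡⇒≈ a b eq = ≈-trans (residue a) (≈-trans (≡⇒≈ (cong +_ eq)) (≈-sym (residue b)))

  ≈0-product : ∀ a b → a * b ≈ + 0 → a ≈ + 0 ⊎ b ≈ + 0
  ≈0-product a b ab≈0
    with euclidsLemma Int.∣ a ∣ Int.∣ b ∣ prime
           (subst (p NatD.∣_) (IntP.abs-* a b) (Signed.∣⇒∣ᵤ (Equivalence.to ≈0⇔∣ ab≈0)))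
  ... | inj₁ p∣a = inj₁ (Equivalence.from ≈0⇔∣ (Signed.∣ᵤ⇒∣ p∣a))
  ... | inj₂ p∣b = inj₂ (Equivalence.from ≈0⇔∣ (Signed.∣ᵤ⇒∣ p∣b))

  ≈0-cancelˡ : ∀ {a b} → a ≉ + 0 → a * b ≈ + 0 → b ≈ + 0
  ≈0-cancelˡ {a} {b} a≉0 ab≈0 with ≈0-product a b ab≈0
  ... | inj₁ a≈0 = ⊥-elim (a≉0 a≈0)
  ... | inj₂ b≈0 = b≈0

  *-≉0 : ∀ {a b} → a ≉ + 0 → b ≉ + 0 → a * b ≉ + 0
  *-≉0 a≉0 b≉0 ab≈0 = b≉0 (≈0-cancelˡ a≉0 ab≈0)

  ≈0-transfer : ∀ {ν μ x y} → ν ≉ + 0 → μ ≉ + 0 → ν * x ≈ μ * y → x ≈ + 0 ⇔ y ≈ + 0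
  ≈0-transfer {ν} {μ} ν≉0 μ≉0 νx≈μy = mk⇔
    (λ x≈0 → ≈0-cancelˡ μ≉0 (≈-trans (≈-sym νx≈μy) (≈-trans (*-congˡ ν x≈0) (≡⇒≈ (IntP.*-zeroʳ ν)))))
    (λ y≈0 → ≈0-cancelˡ ν≉0 (≈-trans νx≈μy (≈-trans (*-congˡ μ y≈0) (≡⇒≈ (IntP.*-zeroʳ μ)))))

  unit-≉0 : ∀ a {b} → a * b ≈ + 1 → b ≉ + 0
  unit-≉0 a ab≈1 b≈0 = 1≉0 (≈-trans (≈-sym ab≈1) (≈-trans (*-congˡ a b≈0) (≡⇒≈ (IntP.*-zeroʳ a))))

  *-cancelˡ : ∀ {a b c} → a ≉ + 0 → a * b ≈ a * c → b ≈ c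
  *-cancelˡ {a} {b} {c} a≉0 ab≈ac =
    mk≈ (Equivalence.to ≈0⇔∣ (≈0-cancelˡ a≉0 (Equivalence.from ≈0⇔∣ (subst (+ p ∣ℤ_) (lemma a b c) (p∣a-b ab≈ac)))))
    where lemma : ∀ a b c → a * b - a * c ≡ a * (b - c)
          lemma = solve-∀

  -- Every nonzero element has a multiplicative inverse (Bézout for its residue and p).
  inverse : ∀ a → a ≉ + 0 → ∃ λ b → a * b ≈ + 1
  inverse a a≉0 = invert (coprime-Bézout (prime⇒coprime prime {{Nat.≢-nonZero r≢0}} (n%ℕd<d a p)))
    where
    r : ℕ
    r = a %ℕ p
    r≢0 : r ≢ 0
    r≢0 r≡0 = a≉0 (≈-trans (residue a) (≡⇒≈ (cong +_ r≡0)))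
    cast : ∀ k l m {n} → k Nat.+ l Nat.* m ≡ n → + k + + l * + m ≡ + n
    cast k l m eq = trans (cong (λ t → + k + t) (sym (IntP.pos-* l m))) (trans (sym (IntP.pos-+ k (l Nat.* m))) (cong +_ eq))
    invert : Bézout.Identity 1 p r → ∃ λ b → a * b ≈ + 1
    invert (Bézout.+- x y eq) = - + y , ≈-trans (*-congʳ (- + y) (residue a)) (multiple⇒≈ (- + x) r·-y≡1-x·p)
      where
      r·-y≡1-x·p : + r * - + y ≡ + 1 + - + x * + p
      r·-y≡1-x·p = begin
        + r * - + y                 ≡⟨ lemma (+ r) (+ y) ⟩
        + 1 + - (+ 1 + + y * + r)   ≡⟨ cong (λ t → + 1 + - t) (cast 1 y r eq) ⟩
        + 1 + - + (x Nat.* p)       ≡⟨ cong (λ t → + 1 + - t) (IntP.pos-* x p) ⟩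
        + 1 + - (+ x * + p)         ≡⟨ cong (λ t → + 1 + t) (IntP.neg-distribˡ-* (+ x) (+ p)) ⟩
        + 1 + - + x * + p           ∎
        where
        open ≡-Reasoning
        lemma : ∀ r y → r * - y ≡ + 1 + - (+ 1 + y * r)
        lemma = solve-∀
    invert (Bézout.-+ x y eq) = + y , ≈-trans (*-congʳ (+ y) (residue a)) (multiple⇒≈ (+ x) r·y≡1+x·p)
      where
      r·y≡1+x·p : + r * + y ≡ + 1 + + x * + p
      r·y≡1+x·p = trans (IntP.*-comm (+ r) (+ y)) (trans (sym (IntP.pos-* y r)) (sym (cast 1 x p eq)))

  inv : (a : ℤ) → a ≉ + 0 → ℤ
  inv a a≉0 = proj₁ (inverse a a≉0)

  inv-spec : ∀ a (a≉0 : a ≉ + 0) → a * inv a a≉0 ≈ + 1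
  inv-spec a a≉0 = proj₂ (inverse a a≉0)

  divide : ℤ → (b : ℤ) → b ≉ + 0 → ℕ
  divide a b b≉0 = (a * inv b b≉0) %ℕ p

  divide<p : ∀ a b (b≉0 : b ≉ + 0) → divide a b b≉0 < p
  divide<p a b b≉0 = n%ℕd<d (a * inv b b≉0) p

  divide-spec : ∀ a b (b≉0 : b ≉ + 0) → a ≈ b * + divide a b b≉0
  divide-spec a b b≉0 = begin
    a                ≡⟨ IntP.*-identityʳ a ⟨
    a * + 1          ≈⟨ *-congˡ a (≈-sym bb⁻¹≈1) ⟩
    a * (b * b⁻¹)    ≡⟨ lemma a b b⁻¹ ⟩
    b * (a * b⁻¹)    ≈⟨ *-congˡ b (residue (a * b⁻¹)) ⟩
    b * + divide a b b≉0 ∎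
    where
    open ≈-Reasoning
    b⁻¹ : ℤ
    b⁻¹ = inv b b≉0
    bb⁻¹≈1 : b * b⁻¹ ≈ + 1
    bb⁻¹≈1 = inv-spec b b≉0
    lemma : ∀ a b c → a * (b * c) ≡ b * (a * c)
    lemma = solve-∀

  divide-unique : ∀ {a b n} (b≉0 : b ≉ + 0) → n < p → a ≈ b * + n → divide a b b≉0 ≡ n
  divide-unique {a} {b} {n} b≉0 n<p a≈bn = ≈-canonical (divide<p a b b≉0) n<p (begin
    + divide a b b≉0   ≈⟨ ≈-sym (residue (a * b⁻¹)) ⟩
    a * b⁻¹            ≈⟨ *-congʳ b⁻¹ a≈bn ⟩
    b * + n * b⁻¹      ≡⟨ lemma b (+ n) b⁻¹ ⟩
    + n * (b * b⁻¹)    ≈⟨ *-congˡ (+ n) bb⁻¹≈1 ⟩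
    + n * + 1          ≡⟨ IntP.*-identityʳ (+ n) ⟩
    + n                ∎)
    where
    open ≈-Reasoning
    b⁻¹ : ℤ
    b⁻¹ = inv b b≉0
    bb⁻¹≈1 : b * b⁻¹ ≈ + 1
    bb⁻¹≈1 = inv-spec b b≉0
    lemma : ∀ a b c → a * b * c ≡ b * (a * c)
    lemma = solve-∀

module ProjectivePlane (p : ℕ) {{_ : NonZero p}} (prime : Prime p) where
  open Int using (_+_; _*_)
  open ModularArithmetic p prime

  -- Coordinate vectors over ℤ, read modulo p.
  Vec3 : Set
  Vec3 = ℤ × ℤ × ℤ

  embed : Triple → Vec3
  embed (x , y , z) = + x , + y , + z

  𝟎 : Vec3
  𝟎 = + 0 , + 0 , + 0

  scale : ℤ → Vec3 → Vec3
  scale μ (x , y , z) = μ * x , μ * y , μ * z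

  infix 4 _≈³_ _≉³_
  record _≈³_ (u v : Vec3) : Set where
    constructor mk≈³
    field
      ≈₁ : proj₁ u ≈ proj₁ v
      ≈₂ : proj₁ (proj₂ u) ≈ proj₁ (proj₂ v)
      ≈₃ : proj₂ (proj₂ u) ≈ proj₂ (proj₂ v)

  _≉³_ : Vec3 → Vec3 → Set
  u ≉³ v = ¬ (u ≈³ v)

  ≈³-setoid : Setoid 0ℓ 0ℓ
  ≈³-setoid = record
    { Carrier = Vec3 ; _≈_ = _≈³_
    ; isEquivalence = record
      { refl  = mk≈³ ≈-refl ≈-refl ≈-refl
      ; sym   = λ (mk≈³ e₁ e₂ e₃) → mk≈³ (≈-sym e₁) (≈-sym e₂) (≈-sym e₃)
      ; trans = λ (mk≈³ e₁ e₂ e₃) (mk≈³ f₁ f₂ f₃) → mk≈³ (≈-trans e₁ f₁) (≈-trans e₂ f₂) (≈-trans e₃ f₃) } }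

  module ≈³ = Setoid ≈³-setoid
  module ≈³-Reasoning = SetoidReasoning ≈³-setoid

  scale-cong : ∀ μ {u v} → u ≈³ v → scale μ u ≈³ scale μ v
  scale-cong μ (mk≈³ e₁ e₂ e₃) = mk≈³ (*-congˡ μ e₁) (*-congˡ μ e₂) (*-congˡ μ e₃)

  scale-congˡ : ∀ {μ ν} v → μ ≈ ν → scale μ v ≈³ scale ν v
  scale-congˡ (x , y , z) μ≈ν = mk≈³ (*-congʳ x μ≈ν) (*-congʳ y μ≈ν) (*-congʳ z μ≈ν)

  scale-scale : ∀ μ ν v → scale μ (scale ν v) ≡ scale (μ * ν) v
  scale-scale μ ν (x , y , z) = cong₂ _,_ (assoc x) (cong₂ _,_ (assoc y) (assoc z))
    where assoc = λ t → sym (IntP.*-assoc μ ν t)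

  scale-one : ∀ v → scale (+ 1) v ≡ v
  scale-one (x , y , z) = cong₂ _,_ (IntP.*-identityˡ x) (cong₂ _,_ (IntP.*-identityˡ y) (IntP.*-identityˡ z))

  scale-𝟎-cancel : ∀ {μ} v → μ ≉ + 0 → scale μ v ≈³ 𝟎 → v ≈³ 𝟎
  scale-𝟎-cancel (x , y , z) μ≉0 (mk≈³ e₁ e₂ e₃) = mk≈³ (≈0-cancelˡ μ≉0 e₁) (≈0-cancelˡ μ≉0 e₂) (≈0-cancelˡ μ≉0 e₃)

  unscale : ∀ {μ ν u v} → μ ≉ + 0 → ν ≉ + 0 → scale μ u ≈³ scale ν v → ∃ λ λ′ → λ′ ≉ + 0 × u ≈³ scale λ′ v
  unscale {μ} {ν} {u} {v} μ≉0 ν≉0 μu≈νv = μ⁻¹ * ν , *-≉0 μ⁻¹≉0 ν≉0 , (begin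
    u                    ≡⟨ scale-one u ⟨
    scale (+ 1) u        ≈⟨ scale-congˡ u (≈-sym μ⁻¹μ≈1) ⟩
    scale (μ⁻¹ * μ) u    ≡⟨ scale-scale μ⁻¹ μ u ⟨
    scale μ⁻¹ (scale μ u) ≈⟨ scale-cong μ⁻¹ μu≈νv ⟩
    scale μ⁻¹ (scale ν v) ≡⟨ scale-scale μ⁻¹ ν v ⟩
    scale (μ⁻¹ * ν) v    ∎)
    where
    open ≈³-Reasoning
    μ⁻¹ : ℤ
    μ⁻¹ = inv μ μ≉0
    μ⁻¹μ≈1 : μ⁻¹ * μ ≈ + 1
    μ⁻¹μ≈1 = ≈-trans (≡⇒≈ (IntP.*-comm μ⁻¹ μ)) (inv-spec μ μ≉0)
    μ⁻¹≉0 : μ⁻¹ ≉ + 0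
    μ⁻¹≉0 = unit-≉0 μ (inv-spec μ μ≉0)

  with1 : ℕ × ℕ → Triple
  with1 yz = 1 , yz

  with01 : ℕ → Triple
  with01 z = 0 , 1 , z

  -- Points p is (definitionally) points₁ ++ points₂ ++ (0,0,1) ∷ [].
  points₁ : List Triple
  points₁ = map with1 (cartesianProduct (upTo p) (upTo p))

  points₂ : List Triple
  points₂ = map with01 (upTo p)

  data Canonical : Triple → Set where
    [1,y,z] : ∀ {y z} → y < p → z < p → Canonical (1 , y , z)
    [0,1,z] : ∀ {z} → z < p → Canonical (0 , 1 , z)
    [0,0,1] : Canonical (0 , 0 , 1)

  canonical⇒∈ : ∀ {P} → Canonical P → P ∈ Points p
  canonical⇒∈ ([1,y,z] y<p z<p) = ∈-++⁺ˡ (∈-map⁺ with1 (∈-cartesianProduct⁺ (∈-upTo⁺ y<p) (∈-upTo⁺ z<p)))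
  canonical⇒∈ ([0,1,z] z<p)     = ∈-++⁺ʳ points₁ (∈-++⁺ˡ (∈-map⁺ with01 (∈-upTo⁺ z<p)))
  canonical⇒∈ [0,0,1]           = ∈-++⁺ʳ points₁ (∈-++⁺ʳ points₂ (here refl))

  ∈⇒canonical : ∀ {P} → P ∈ Points p → Canonical P
  ∈⇒canonical P∈ with ∈-++⁻ points₁ P∈
  ... | inj₁ P∈₁ with ∈-map⁻ with1 P∈₁
  ...   | _ , yz∈ , refl with ∈-cartesianProduct⁻ (upTo p) (upTo p) yz∈
  ...     | y∈ , z∈ = [1,y,z] (∈-upTo⁻ y∈) (∈-upTo⁻ z∈)
  ∈⇒canonical P∈ | inj₂ P∈₂₃ with ∈-++⁻ points₂ P∈₂₃
  ... | inj₁ P∈₂ with ∈-map⁻ with01 P∈₂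
  ...   | _ , z∈ , refl = [0,1,z] (∈-upTo⁻ z∈)
  ∈⇒canonical P∈ | inj₂ P∈₂₃ | inj₂ (here refl) = [0,0,1]

  Points-unique : Unique (Points p)
  Points-unique = Unique.++⁺ unique₁ (Unique.++⁺ unique₂ (All.[] ∷ []) disjoint₂₃) disjoint₁
    where
    unique₁ : Unique points₁
    unique₁ = Unique.map⁺ (cong proj₂) (Unique.cartesianProduct⁺ (Unique.upTo⁺ p) (Unique.upTo⁺ p))
    unique₂ : Unique points₂
    unique₂ = Unique.map⁺ (cong (λ P → proj₂ (proj₂ P))) (Unique.upTo⁺ p)
    disjoint₂₃ : ∀ {P} → ¬ (P ∈ points₂ × P ∈ (0 , 0 , 1) ∷ [])
    disjoint₂₃ (P∈₂ , here refl) with ∈-map⁻ with01 P∈₂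
    ... | _ , _ , ()
    first-is-0 : ∀ {P} → P ∈ points₂ ++ (0 , 0 , 1) ∷ [] → proj₁ P ≡ 0
    first-is-0 P∈₂₃ with ∈-++⁻ points₂ P∈₂₃
    ... | inj₁ P∈₂ with ∈-map⁻ with01 P∈₂
    ...   | _ , _ , refl = refl
    first-is-0 P∈₂₃ | inj₂ (here refl) = refl
    disjoint₁ : ∀ {P} → ¬ (P ∈ points₁ × P ∈ points₂ ++ (0 , 0 , 1) ∷ [])
    disjoint₁ (P∈₁ , P∈₂₃) with ∈-map⁻ with1 P∈₁ | first-is-0 P∈₂₃
    ... | _ , _ , refl | ()

  embed-≉³𝟎 : ∀ {P} → P ∈ Points p → embed P ≉³ 𝟎
  embed-≉³𝟎 P∈ with ∈⇒canonical P∈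
  ... | [1,y,z] _ _ = λ (mk≈³ 1≈0 _ _) → 1≉0 1≈0
  ... | [0,1,z] _   = λ (mk≈³ _ 1≈0 _) → 1≉0 1≈0
  ... | [0,0,1]     = λ (mk≈³ _ _ 1≈0) → 1≉0 1≈0

  normalise : Vec3 → Triple
  normalise (x , y , z) with x ≈0? | y ≈0?
  ... | no x≉0 | _      = 1 , divide y x x≉0 , divide z x x≉0
  ... | yes _  | no y≉0 = 0 , 1 , divide z y y≉0
  ... | yes _  | yes _  = 0 , 0 , 1

  normalise-∈ : ∀ v → normalise v ∈ Points p
  normalise-∈ (x , y , z) with x ≈0? | y ≈0?
  ... | no x≉0 | _      = canonical⇒∈ ([1,y,z] (divide<p y x x≉0) (divide<p z x x≉0))
  ... | yes _  | no y≉0 = canonical⇒∈ ([0,1,z] (divide<p z y y≉0))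
  ... | yes _  | yes _  = canonical⇒∈ [0,0,1]

  private
    ≈*1 : ∀ μ → μ ≈ μ * + 1
    ≈*1 μ = ≡⇒≈ (sym (IntP.*-identityʳ μ))

    ≈0⇒≈*0 : ∀ {a} μ → a ≈ + 0 → a ≈ μ * + 0
    ≈0⇒≈*0 μ a≈0 = ≈-trans a≈0 (≡⇒≈ (sym (IntP.*-zeroʳ μ)))

    ≈*0⇒≈0 : ∀ {a} μ → a ≈ μ * + 0 → a ≈ + 0
    ≈*0⇒≈0 μ a≈μ0 = ≈-trans a≈μ0 (≡⇒≈ (IntP.*-zeroʳ μ))

    ≈*1⇒≈ : ∀ {a} μ → a ≈ μ * + 1 → a ≈ μ
    ≈*1⇒≈ μ a≈μ1 = ≈-trans a≈μ1 (≡⇒≈ (IntP.*-identityʳ μ))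

  normalise-spec : ∀ v → v ≉³ 𝟎 → ∃ λ μ → μ ≉ + 0 × v ≈³ scale μ (embed (normalise v))
  normalise-spec (x , y , z) v≉0 with x ≈0? | y ≈0?
  ... | no x≉0  | _      = x , x≉0 , mk≈³ (≈*1 x) (divide-spec y x x≉0) (divide-spec z x x≉0)
  ... | yes x≈0 | no y≉0 = y , y≉0 , mk≈³ (≈0⇒≈*0 y x≈0) (≈*1 y) (divide-spec z y y≉0)
  ... | yes x≈0 | yes y≈0 with z ≈0?
  ...   | yes z≈0 = ⊥-elim (v≉0 (mk≈³ x≈0 y≈0 z≈0))
  ...   | no z≉0  = z , z≉0 , mk≈³ (≈0⇒≈*0 z x≈0) (≈0⇒≈*0 z y≈0) (≈*1 z)

  normalise-unique : ∀ {P μ} v → P ∈ Points p → μ ≉ + 0 → v ≈³ scale μ (embed P) → normalise v ≡ P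
  normalise-unique {μ = μ} (x , y , z) P∈ μ≉0 (mk≈³ x≈ y≈ z≈) with ∈⇒canonical P∈ | x ≈0? | y ≈0?
  ... | [1,y,z] y<p z<p | no x≉0  | _       =
    cong₂ (λ s t → 1 , s , t) (divide-unique x≉0 y<p (over x≈ y≈)) (divide-unique x≉0 z<p (over x≈ z≈))
    where over : ∀ {a n} → x ≈ μ * + 1 → a ≈ μ * + n → a ≈ x * + n
          over {n = n} x≈μ a≈ = ≈-trans a≈ (*-congʳ (+ n) (≈-sym (≈*1⇒≈ μ x≈μ)))
  ... | [1,y,z] _ _     | yes x≈0 | _       = ⊥-elim (μ≉0 (≈-trans (≈-sym (≈*1⇒≈ μ x≈)) x≈0))
  ... | [0,1,z] _       | no x≉0  | _       = ⊥-elim (x≉0 (≈*0⇒≈0 μ x≈))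
  ... | [0,1,z] z<p     | yes _   | no y≉0  =
    cong (λ t → 0 , 1 , t) (divide-unique y≉0 z<p (≈-trans z≈ (*-congʳ _ (≈-sym (≈*1⇒≈ μ y≈)))))
  ... | [0,1,z] _       | yes _   | yes y≈0 = ⊥-elim (μ≉0 (≈-trans (≈-sym (≈*1⇒≈ μ y≈)) y≈0))
  ... | [0,0,1]         | no x≉0  | _       = ⊥-elim (x≉0 (≈*0⇒≈0 μ x≈))
  ... | [0,0,1]         | yes _   | no y≉0  = ⊥-elim (y≉0 (≈*0⇒≈0 μ y≈))
  ... | [0,0,1]         | yes _   | yes _   = refl

  dot : Vec3 → Vec3 → ℤ
  dot (a , b , c) (x , y , z) = a * x + b * y + c * z

  dot-cong : ∀ {u u′ v v′} → u ≈³ u′ → v ≈³ v′ → dot u v ≈ dot u′ v′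
  dot-cong (mk≈³ a b c) (mk≈³ x y z) = +-cong (+-cong (*-cong a x) (*-cong b y)) (*-cong c z)

  dot-scaleˡ : ∀ μ u v → dot (scale μ u) v ≡ μ * dot u v
  dot-scaleˡ μ (a , b , c) (x , y , z) = lemma μ a b c x y z
    where lemma : ∀ μ a b c x y z → μ * a * x + μ * b * y + μ * c * z ≡ μ * (a * x + b * y + c * z)
          lemma = solve-∀

  dot-scaleʳ : ∀ μ u v → dot u (scale μ v) ≡ μ * dot u v
  dot-scaleʳ μ (a , b , c) (x , y , z) = lemma μ a b c x y z
    where lemma : ∀ μ a b c x y z → a * (μ * x) + b * (μ * y) + c * (μ * z) ≡ μ * (a * x + b * y + c * z)
          lemma = solve-∀

  dot-𝟎ʳ : ∀ u → dot u 𝟎 ≡ + 0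
  dot-𝟎ʳ (a , b , c) = lemma a b c
    where lemma : ∀ a b c → a * + 0 + b * + 0 + c * + 0 ≡ + 0
          lemma = solve-∀

  Incident⇔ : ∀ L P → Incident p L P ⇔ dot (embed L) (embed P) ≈ + 0
  Incident⇔ (a , b , c) (x , y , z) = mk⇔
    (λ p∣ → subst (_≈ + 0) cast (Equivalence.from ℕ≈0⇔∣ p∣))
    (λ ≈0 → Equivalence.to ℕ≈0⇔∣ (subst (_≈ + 0) (sym cast) ≈0))
    where
    cast : + (a Nat.* x Nat.+ b Nat.* y Nat.+ c Nat.* z) ≡ dot (embed (a , b , c)) (embed (x , y , z))
    cast = trans (IntP.pos-+ (a Nat.* x Nat.+ b Nat.* y) (c Nat.* z))
             (cong₂ _+_ (trans (IntP.pos-+ (a Nat.* x) (b Nat.* y)) (cong₂ _+_ (IntP.pos-* a x) (IntP.pos-* b y)))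
                        (IntP.pos-* c z))

-- Invertible 3×3 matrices act on PG(2,p) as collineations: M moves the points, and the
-- transpose of M pulls the lines back so that incidence is preserved.
module Collineations (p : ℕ) {{_ : NonZero p}} (prime : Prime p) where
  open Int using (_+_; _*_; -_; _-_)
  open ModularArithmetic p prime
  open ProjectivePlane p prime

  -- 3×3 integer matrices, given by their rows.
  Matrix : Set
  Matrix = Vec3 × Vec3 × Vec3

  apply : Matrix → Vec3 → Vec3
  apply (r₁ , r₂ , r₃) v = dot r₁ v , dot r₂ v , dot r₃ v

  transpose : Matrix → Matrix
  transpose ((a , b , c) , (d , e , f) , (g , h , i)) = (a , d , g) , (b , e , h) , (c , f , i)

  cross : Vec3 → Vec3 → Vec3
  cross (a , b , c) (d , e , f) = b * f - c * e , c * d - a * f , a * e - b * d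

  adjugate : Matrix → Matrix
  adjugate (r₁ , r₂ , r₃) = transpose (cross r₂ r₃ , cross r₃ r₁ , cross r₁ r₂)

  det : Matrix → ℤ
  det (r₁ , r₂ , r₃) = dot r₁ (cross r₂ r₃)

  adjugate-right : ∀ M v → apply M (apply (adjugate M) v) ≡ scale (det M) v
  adjugate-right ((a , b , c) , (d , e , f) , (g , h , i)) (x , y , z) =
    cong₂ _,_ (row₁ a b c d e f g h i x y z) (cong₂ _,_ (row₂ a b c d e f g h i x y z) (row₃ a b c d e f g h i x y z))
    where
    row₁ : ∀ a b c d e f g h i x y z →
      a * ((e * i - f * h) * x + (h * c - i * b) * y + (b * f - c * e) * z) +
      b * ((f * g - d * i) * x + (i * a - g * c) * y + (c * d - a * f) * z) +
      c * ((d * h - e * g) * x + (g * b - h * a) * y + (a * e - b * d) * z)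
      ≡ (a * (e * i - f * h) + b * (f * g - d * i) + c * (d * h - e * g)) * x
    row₁ = solve-∀
    row₂ : ∀ a b c d e f g h i x y z →
      d * ((e * i - f * h) * x + (h * c - i * b) * y + (b * f - c * e) * z) +
      e * ((f * g - d * i) * x + (i * a - g * c) * y + (c * d - a * f) * z) +
      f * ((d * h - e * g) * x + (g * b - h * a) * y + (a * e - b * d) * z)
      ≡ (a * (e * i - f * h) + b * (f * g - d * i) + c * (d * h - e * g)) * y
    row₂ = solve-∀
    row₃ : ∀ a b c d e f g h i x y z →
      g * ((e * i - f * h) * x + (h * c - i * b) * y + (b * f - c * e) * z) +
      h * ((f * g - d * i) * x + (i * a - g * c) * y + (c * d - a * f) * z) +
      i * ((d * h - e * g) * x + (g * b - h * a) * y + (a * e - b * d) * z)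
      ≡ (a * (e * i - f * h) + b * (f * g - d * i) + c * (d * h - e * g)) * z
    row₃ = solve-∀

  adjugate-left : ∀ M v → apply (adjugate M) (apply M v) ≡ scale (det M) v
  adjugate-left ((a , b , c) , (d , e , f) , (g , h , i)) (x , y , z) =
    cong₂ _,_ (row₁ a b c d e f g h i x y z) (cong₂ _,_ (row₂ a b c d e f g h i x y z) (row₃ a b c d e f g h i x y z))
    where
    row₁ : ∀ a b c d e f g h i x y z →
      (e * i - f * h) * (a * x + b * y + c * z) + (h * c - i * b) * (d * x + e * y + f * z) +
      (b * f - c * e) * (g * x + h * y + i * z)
      ≡ (a * (e * i - f * h) + b * (f * g - d * i) + c * (d * h - e * g)) * x
    row₁ = solve-∀
    row₂ : ∀ a b c d e f g h i x y z →
      (f * g - d * i) * (a * x + b * y + c * z) + (i * a - g * c) * (d * x + e * y + f * z) +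
      (c * d - a * f) * (g * x + h * y + i * z)
      ≡ (a * (e * i - f * h) + b * (f * g - d * i) + c * (d * h - e * g)) * y
    row₂ = solve-∀
    row₃ : ∀ a b c d e f g h i x y z →
      (d * h - e * g) * (a * x + b * y + c * z) + (g * b - h * a) * (d * x + e * y + f * z) +
      (a * e - b * d) * (g * x + h * y + i * z)
      ≡ (a * (e * i - f * h) + b * (f * g - d * i) + c * (d * h - e * g)) * z
    row₃ = solve-∀

  det-transpose : ∀ M → det (transpose M) ≡ det M
  det-transpose ((a , b , c) , (d , e , f) , (g , h , i)) = lemma a b c d e f g h i
    where
    lemma : ∀ a b c d e f g h i →
      a * (e * i - h * f) + d * (h * c - b * i) + g * (b * f - e * c)
      ≡ a * (e * i - f * h) + b * (f * g - d * i) + c * (d * h - e * g)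
    lemma = solve-∀

  dot-transpose : ∀ M u v → dot (apply (transpose M) u) v ≡ dot u (apply M v)
  dot-transpose ((a , b , c) , (d , e , f) , (g , h , i)) (l , m , n) (x , y , z) = lemma a b c d e f g h i l m n x y z
    where
    lemma : ∀ a b c d e f g h i l m n x y z →
            (a * l + d * m + g * n) * x + (b * l + e * m + h * n) * y + (c * l + f * m + i * n) * z
            ≡ l * (a * x + b * y + c * z) + m * (d * x + e * y + f * z) + n * (g * x + h * y + i * z)
    lemma = solve-∀

  apply-cong : ∀ M {u v} → u ≈³ v → apply M u ≈³ apply M v
  apply-cong (r₁ , r₂ , r₃) u≈v = mk≈³ (dot-cong (≈³.refl {r₁}) u≈v) (dot-cong (≈³.refl {r₂}) u≈v) (dot-cong (≈³.refl {r₃}) u≈v)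

  apply-scale : ∀ M μ v → apply M (scale μ v) ≡ scale μ (apply M v)
  apply-scale (r₁ , r₂ , r₃) μ v = cong₂ _,_ (dot-scaleʳ μ r₁ v) (cong₂ _,_ (dot-scaleʳ μ r₂ v) (dot-scaleʳ μ r₃ v))

  apply-𝟎 : ∀ M → apply M 𝟎 ≡ 𝟎
  apply-𝟎 (r₁ , r₂ , r₃) = cong₂ _,_ (dot-𝟎ʳ r₁) (cong₂ _,_ (dot-𝟎ʳ r₂) (dot-𝟎ʳ r₃))

  record Inverts (N M : Matrix) (r : ℤ) : Set where
    constructor inverts
    field undo : ∀ v → apply N (apply M v) ≡ scale r v
  open Inverts public

  adjugate-inverts : ∀ M → Inverts (adjugate M) M (det M)
  adjugate-inverts M = inverts (adjugate-left M)

  inverts-adjugate : ∀ M → Inverts M (adjugate M) (det M)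
  inverts-adjugate M = inverts (adjugate-right M)

  record Invertible (M : Matrix) : Set where
    constructor invertible
    field det≉0 : det M ≉ + 0
  open Invertible public

  apply-≉³𝟎 : ∀ {N M r v} → Inverts N M r → r ≉ + 0 → v ≉³ 𝟎 → apply M v ≉³ 𝟎
  apply-≉³𝟎 {N} {M} {r} {v} N∘M r≉0 v≉0 Mv≈0 = v≉0 (scale-𝟎-cancel v r≉0 (begin
    scale r v             ≡⟨ undo N∘M v ⟨
    apply N (apply M v)   ≈⟨ apply-cong N Mv≈0 ⟩
    apply N 𝟎             ≡⟨ apply-𝟎 N ⟩
    𝟎                     ∎))
    where open ≈³-Reasoning

  image : Matrix → Triple → Triple
  image M P = normalise (apply M (embed P))

  image-∈ : ∀ M P → image M P ∈ Points p
  image-∈ M P = normalise-∈ (apply M (embed P))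

  image-representative : ∀ {N M r P} → Inverts N M r → r ≉ + 0 → P ∈ Points p →
                         ∃ λ μ → μ ≉ + 0 × apply M (embed P) ≈³ scale μ (embed (image M P))
  image-representative N∘M r≉0 P∈ = normalise-spec _ (apply-≉³𝟎 N∘M r≉0 (embed-≉³𝟎 P∈))

  image-inverse : ∀ {N M r P} → Inverts N M r → r ≉ + 0 → P ∈ Points p → image N (image M P) ≡ P
  image-inverse {N} {M} {r} {P} N∘M r≉0 P∈ =
    let μ , μ≉0 , MP≈μP′ = image-representative N∘M r≉0 P∈
        λ′ , λ′≉0 , NP′≈λ′P = unscale μ≉0 r≉0 (N-undoes μ MP≈μP′)
    in normalise-unique _ P∈ λ′≉0 NP′≈λ′P
    where
    P′ : Triple
    P′ = image M P
    N-undoes : ∀ μ → apply M (embed P) ≈³ scale μ (embed P′) → scale μ (apply N (embed P′)) ≈³ scale r (embed P)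
    N-undoes μ MP≈μP′ = begin
      scale μ (apply N (embed P′))   ≡⟨ apply-scale N μ (embed P′) ⟨
      apply N (scale μ (embed P′))   ≈⟨ apply-cong N (≈³.sym MP≈μP′) ⟩
      apply N (apply M (embed P))    ≡⟨ undo N∘M (embed P) ⟩
      scale r (embed P)              ∎
      where open ≈³-Reasoning

  transpose-invertible : ∀ {M} → Invertible M → Invertible (transpose M)
  transpose-invertible {M} (invertible det≉0) = invertible (subst (_≉ + 0) (sym (det-transpose M)) det≉0)

  count-image : ∀ {M} → Invertible M → {D₁ D₂ : Pred Triple 0ℓ} (D₁? : Decidable D₁) (D₂? : Decidable D₂) →
                (∀ {P} → P ∈ Points p → D₁ P ⇔ D₂ (image M P)) →
                length (filter D₁? (Points p)) ≡ length (filter D₂? (Points p))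
  count-image {M} M-inv D₁? D₂? D₁⇔D₂ =
    Counting.count-bijection (Points p) Points-unique D₁? D₂? (image M) (image (adjugate M))
      (λ {P} _ → image-∈ M P) (λ {P} _ → image-∈ (adjugate M) P)
      (image-inverse (adjugate-inverts M) (det≉0 M-inv)) (image-inverse (inverts-adjugate M) (det≉0 M-inv)) D₁⇔D₂

  incidence-transpose : ∀ {M L Q} → Invertible M → L ∈ Points p → Q ∈ Points p →
                        Incident p (image (transpose M) L) Q ⇔ Incident p L (image M Q)
  incidence-transpose {M} {L} {Q} M-inv L∈ Q∈ =
    let ν , ν≉0 , MᵀL≈νL′ = image-representative (adjugate-inverts (transpose M)) (det≉0 (transpose-invertible M-inv)) L∈
        μ , μ≉0 , MQ≈μQ′ = image-representative (adjugate-inverts M) (det≉0 M-inv) Q∈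
    in ⇔.trans (Incident⇔ L′ Q)
         (⇔.trans (≈0-transfer ν≉0 μ≉0 (pairing ν μ MᵀL≈νL′ MQ≈μQ′)) (⇔.sym (Incident⇔ L Q′)))
    where
    L′ Q′ : Triple
    L′ = image (transpose M) L
    Q′ = image M Q
    pairing : ∀ ν μ → apply (transpose M) (embed L) ≈³ scale ν (embed L′) → apply M (embed Q) ≈³ scale μ (embed Q′) →
              ν * dot (embed L′) (embed Q) ≈ μ * dot (embed L) (embed Q′)
    pairing ν μ MᵀL≈νL′ MQ≈μQ′ = begin
      ν * dot (embed L′) (embed Q)                  ≡⟨ dot-scaleˡ ν (embed L′) (embed Q) ⟨
      dot (scale ν (embed L′)) (embed Q)            ≈⟨ dot-cong (≈³.sym MᵀL≈νL′) (≈³.refl {embed Q}) ⟩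
      dot (apply (transpose M) (embed L)) (embed Q) ≡⟨ dot-transpose M (embed L) (embed Q) ⟩
      dot (embed L) (apply M (embed Q))             ≈⟨ dot-cong (≈³.refl {embed L}) MQ≈μQ′ ⟩
      dot (embed L) (scale μ (embed Q′))            ≡⟨ dot-scaleʳ μ (embed L) (embed Q′) ⟩
      μ * dot (embed L) (embed Q′)                  ∎
      where open ≈-Reasoning

module Conics (p : ℕ) {{_ : NonZero p}} (prime : Prime p) (c : ℕ) where
  open Int using (_+_; _*_; -_; _-_)
  open ModularArithmetic p prime
  open ProjectivePlane p prime
  open Collineations p prime

  form : ℤ → Vec3 → ℤ
  form k (x , y , z) = x * x + k * y * y + + c * k * z * z

  OnConic⇔ : ∀ k P → OnConic p c k P ⇔ form (+ k) (embed P) ≈ + 0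
  OnConic⇔ k (x , y , z) = mk⇔
    (λ p∣ → subst (_≈ + 0) cast (Equivalence.from ℕ≈0⇔∣ p∣))
    (λ ≈0 → Equivalence.to ℕ≈0⇔∣ (subst (_≈ + 0) (sym cast) ≈0))
    where
    cast : + (x Nat.* x Nat.+ k Nat.* y Nat.* y Nat.+ c Nat.* k Nat.* z Nat.* z) ≡ form (+ k) (+ x , + y , + z)
    cast = trans (IntP.pos-+ (x Nat.* x Nat.+ k Nat.* y Nat.* y) (c Nat.* k Nat.* z Nat.* z))
      (cong₂ _+_
        (trans (IntP.pos-+ (x Nat.* x) (k Nat.* y Nat.* y))
          (cong₂ _+_ (IntP.pos-* x x) (trans (IntP.pos-* (k Nat.* y) y) (cong (_* + y) (IntP.pos-* k y)))))
        (trans (IntP.pos-* (c Nat.* k Nat.* z) z) (cong (_* + z) (trans (IntP.pos-* (c Nat.* k) z) (cong (_* + z) (IntP.pos-* c k))))))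

  form-congʳ : ∀ k {u v} → u ≈³ v → form k u ≈ form k v
  form-congʳ k (mk≈³ x y z) =
    +-cong (+-cong (*-cong x x) (*-cong (*-congˡ k y) y)) (*-cong (*-congˡ (+ c * k) z) z)

  form-congˡ : ∀ v {k k′} → k ≈ k′ → form k v ≈ form k′ v
  form-congˡ (x , y , z) {k} {k′} k≈k′ =
    +-cong (+-congˡ (x * x) (*-congʳ y (*-congʳ y k≈k′))) (*-congʳ z (*-congʳ z (*-congˡ (+ c) k≈k′)))

  form-scale : ∀ k μ v → form k (scale μ v) ≡ μ * μ * form k v
  form-scale k μ (x , y , z) = lemma (+ c) k μ x y z
    where
    lemma : ∀ c k μ x y z →
      μ * x * (μ * x) + k * (μ * y) * (μ * y) + c * k * (μ * z) * (μ * z) ≡ μ * μ * (x * x + k * y * y + c * k * z * z)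
    lemma = solve-∀

  Carries : Matrix → ℕ → ℕ → Set
  Carries M k′ k = ∀ v → form (+ k) (apply M v) ≈ form (+ k′) v

  module _ {M : Matrix} {k′ k : ℕ} (M-inv : Invertible M) (M-carries : Carries M k′ k) where

    conic-image : ∀ {P} → P ∈ Points p → OnConic p c k′ P ⇔ OnConic p c k (image M P)
    conic-image {P} P∈ =
      let μ , μ≉0 , MP≈μP′ = image-representative (adjugate-inverts M) (det≉0 M-inv) P∈
      in ⇔.trans (OnConic⇔ k′ P)
           (⇔.trans (≈0-transfer 1≉0 (*-≉0 μ≉0 μ≉0) (pull-back μ MP≈μP′)) (⇔.sym (OnConic⇔ k P′)))
      where
      P′ : Triple
      P′ = image M P
      pull-back : ∀ μ → apply M (embed P) ≈³ scale μ (embed P′) →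
                  + 1 * form (+ k′) (embed P) ≈ μ * μ * form (+ k) (embed P′)
      pull-back μ MP≈μP′ = begin
        + 1 * form (+ k′) (embed P)        ≡⟨ IntP.*-identityˡ _ ⟩
        form (+ k′) (embed P)              ≈⟨ ≈-sym (M-carries (embed P)) ⟩
        form (+ k) (apply M (embed P))     ≈⟨ form-congʳ (+ k) MP≈μP′ ⟩
        form (+ k) (scale μ (embed P′))    ≡⟨ form-scale (+ k) μ (embed P′) ⟩
        μ * μ * form (+ k) (embed P′)      ∎
        where open ≈-Reasoning

    -- Lines move by the transpose: L is a tangent of O_k iff Mᵀ·L is a tangent of O_k′,
    -- because M matches the points of O_k′ on Mᵀ·L with the points of O_k on L.
    tangent-transpose : ∀ {L} → L ∈ Points p → Tangent p c k L ⇔ Tangent p c k′ (image (transpose M) L)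
    tangent-transpose {L} L∈ = mk⇔ (trans same-count) (trans (sym same-count))
      where
      same-count : length (conicPointsOn p c k′ (image (transpose M) L)) ≡ length (conicPointsOn p c k L)
      same-count = count-image M-inv
        (λ Q → Incident? p (image (transpose M) L) Q ×-dec OnConic? p c k′ Q)
        (λ Q → Incident? p L Q ×-dec OnConic? p c k Q)
        (λ Q∈ → incidence-transpose M-inv L∈ Q∈ ×-⇔ conic-image Q∈)

    -- P is exterior to O_k′ iff M·P is exterior to O_k: Mᵀ matches the tangents of O_k through M·P
    -- with the tangents of O_k′ through P.
    exterior-image : ∀ {P} → P ∈ Points p → Exterior p c k′ P ⇔ Exterior p c k (image M P)
    exterior-image {P} P∈ = mk⇔ (trans same-count) (trans (sym same-count))
      where
      same-count : length (tangentsThrough p c k (image M P)) ≡ length (tangentsThrough p c k′ P)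
      same-count = count-image (transpose-invertible M-inv)
        (λ L → Incident? p L (image M P) ×-dec Tangent? p c k L)
        (λ L → Incident? p L P ×-dec Tangent? p c k′ L)
        (λ L∈ → ⇔.sym (incidence-transpose M-inv L∈ P∈) ×-⇔ tangent-transpose L∈)

  diamond-transfer : ∀ {M α′ α β′ β} → Invertible M → Carries M α′ α → Carries M β′ β →
                     Diamond p c α β → Diamond p c α′ β′
  diamond-transfer {M} M-inv carries-α carries-β α⋄β P P∈ P-on-β′ =
    Equivalence.from (exterior-image M-inv carries-α P∈)
      (α⋄β (image M P) (image-∈ M P) (Equivalence.to (conic-image M-inv carries-β P∈) P-on-β′))

  -- The norm form a² + c b²  (the norm of a + b√−c).
  normForm : ℤ → ℤ → ℤ
  normForm a b = a * a + + c * b * b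

  -- The "rotation" (x, y, z) ↦ (x, a y − c b z, b y + a z): multiplication by a + b√−c on (y, z).
  rotation : ℤ → ℤ → Matrix
  rotation a b = (+ 1 , + 0 , + 0) , (+ 0 , a , - (+ c * b)) , (+ 0 , b , a)

  det-rotation : ∀ a b → det (rotation a b) ≡ normForm a b
  det-rotation a b = lemma (+ c) a b
    where
    lemma : ∀ c a b → + 1 * (a * a - - (c * b) * b) + + 0 * (- (c * b) * + 0 - + 0 * a) + + 0 * (+ 0 * b - a * + 0)
                      ≡ a * a + c * b * b
    lemma = solve-∀

  form-rotation : ∀ k a b v → form k (apply (rotation a b) v) ≡ form (k * normForm a b) v
  form-rotation k a b (x , y , z) = lemma (+ c) k a b x y z
    where
    lemma : ∀ c k a b x y z →
      (+ 1 * x + + 0 * y + + 0 * z) * (+ 1 * x + + 0 * y + + 0 * z)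
      + k * (+ 0 * x + a * y + - (c * b) * z) * (+ 0 * x + a * y + - (c * b) * z)
      + c * k * (+ 0 * x + b * y + a * z) * (+ 0 * x + b * y + a * z)
      ≡ x * x + k * (a * a + c * b * b) * y * y + c * (k * (a * a + c * b * b)) * z * z
    lemma = solve-∀

  rotation-carries : ∀ a b {k′ k} → + k′ ≈ + k * normForm a b → Carries (rotation a b) k′ k
  rotation-carries a b {k′} {k} k′≈kr v = begin
    form (+ k) (apply (rotation a b) v)   ≡⟨ form-rotation (+ k) a b v ⟩
    form (+ k * normForm a b) v           ≈⟨ form-congˡ v (≈-sym k′≈kr) ⟩
    form (+ k′) v                         ∎
    where open ≈-Reasoning

module NormForm (p : ℕ) {{_ : NonZero p}} (prime : Prime p) (m : ℕ) (p≡2m+1 : p ≡ suc (m Nat.+ m))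
                (c : ℕ) (c<p : c < p) (c≢0 : c ≢ 0) where
  open Int using (_+_; _*_; -_; _-_)
  open ModularArithmetic p prime
  open Conics p prime c using (normForm)

  m+m<p : m Nat.+ m < p
  m+m<p = subst (m Nat.+ m <_) (sym p≡2m+1) (NatP.n<1+n (m Nat.+ m))

  -- The squares of 0, 1, …, m are pairwise incongruent: y² − x² = (y − x)(y + x) with both factors in (0, p).
  squares-distinct : ∀ {x y} → x < y → y ≤ m → + x * + x ≉ + y * + y
  squares-distinct {x} {y} x<y y≤m x²≈y² with ≈0-product (+ d) (+ s) ds≈0
    where
    d s : ℕ
    d = y ∸ x
    s = x Nat.+ y
    +y≡+x++d : + y ≡ + x + + d
    +y≡+x++d = trans (cong +_ (sym (NatP.m+[n∸m]≡n (NatP.<⇒≤ x<y)))) (IntP.pos-+ x d)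
    difference : + y * + y - + x * + x ≡ + d * + s
    difference = begin
      + y * + y - + x * + x               ≡⟨ cong (λ u → u * u - + x * + x) +y≡+x++d ⟩
      (+ x + + d) * (+ x + + d) - + x * + x ≡⟨ lemma (+ x) (+ d) ⟩
      + d * (+ x + (+ x + + d))           ≡⟨ cong (λ u → + d * (+ x + u)) +y≡+x++d ⟨
      + d * (+ x + + y)                   ≡⟨ cong (+ d *_) (IntP.pos-+ x y) ⟨
      + d * + s                           ∎
      where
      open ≡-Reasoning
      lemma : ∀ x d → (x + d) * (x + d) - x * x ≡ d * (x + (x + d))
      lemma = solve-∀
    ds≈0 : + d * + s ≈ + 0
    ds≈0 = Equivalence.from ≈0⇔∣ (subst (+ p ∣ℤ_) difference (p∣a-b (≈-sym x²≈y²)))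
  -- 0 < d ≤ y ≤ m < p  and  0 < s ≤ 2m < p
  ... | inj₁ d≈0 = small≉0 (NatP.m<n⇒n≢0 (NatP.m<n⇒0<n∸m x<y))
                     (NatP.≤-<-trans (NatP.m∸n≤m y x) (NatP.≤-<-trans y≤m (NatP.≤-<-trans (NatP.m≤m+n m m) m+m<p))) d≈0
  ... | inj₂ s≈0 = small≉0 (λ x+y≡0 → NatP.m<n⇒n≢0 x<y (NatP.m+n≡0⇒n≡0 x x+y≡0))
                     (NatP.≤-<-trans (NatP.+-mono-≤ (NatP.≤-trans (NatP.<⇒≤ x<y) y≤m) y≤m) m+m<p) s≈0

  -- The p + 1 candidates i² (0 ≤ i ≤ m) and t − c j² (j = i − m − 1, 0 ≤ j ≤ m), indexed by i ≤ p.
  candidate : ℤ → (i : ℕ) → Dec (i ≤ m) → ℤ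
  candidate t i (yes _) = + i * + i
  candidate t i (no _)  = t - + c * (+ (i ∸ suc m) * + (i ∸ suc m))

  -- Two candidates that collide give a representation of t: squares do not collide among
  -- themselves, nor do the t − c j², so the collision is i² ≈ t − c j².
  collision⇒representation : ∀ t {i j} → i < j → j ≤ p → (i≤m? : Dec (i ≤ m)) (j≤m? : Dec (j ≤ m)) →
    candidate t i i≤m? ≈ candidate t j j≤m? → ∃₂ λ a b → normForm a b ≈ t
  collision⇒representation t i<j j≤p (yes _) (yes j≤m) i²≈j² = ⊥-elim (squares-distinct i<j j≤m i²≈j²)
  collision⇒representation t i<j j≤p (no i≰m) (yes j≤m) _    = ⊥-elim (i≰m (NatP.<⇒≤ (NatP.<-≤-trans i<j j≤m)))
  collision⇒representation t {i} {j} i<j j≤p (yes _) (no _) i²≈t-cb² = + i , + b , (begin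
    + i * + i + + c * + b * + b                   ≈⟨ +-cong i²≈t-cb² (≈-refl {+ c * + b * + b}) ⟩
    t - + c * (+ b * + b) + + c * + b * + b       ≡⟨ lemma t (+ c) (+ b) ⟩
    t                                             ∎)
    where
    open ≈-Reasoning
    b : ℕ
    b = j ∸ suc m
    lemma : ∀ t c b → t - c * (b * b) + c * b * b ≡ t
    lemma = solve-∀
  collision⇒representation t {i} {j} i<j j≤p (no i≰m) (no _) t-ci′²≈t-cj′² =
    ⊥-elim (squares-distinct i′<j′ j′≤m (*-cancelˡ (small≉0 c≢0 c<p) (−-cancelˡ t t-ci′²≈t-cj′²)))
    where
    i′<j′ : i ∸ suc m < j ∸ suc m
    i′<j′ = NatP.∸-monoˡ-< i<j (NatP.≰⇒> i≰m)
    j′≤m : j ∸ suc m ≤ m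
    j′≤m = NatP.m≤n+o⇒m∸n≤o j (suc m) (subst (j ≤_) p≡2m+1 j≤p)

  -- Every t is a value of the norm form, by the pigeonhole principle on the residues of the candidates.
  normForm-surjective : ∀ t → ∃₂ λ a b → normForm a b ≈ t
  normForm-surjective t =
    let i , j , i<j , same = pigeonhole (NatP.n<1+n p) residue-of
    in collision⇒representation t i<j (NatP.≤-pred (toℕ<n j)) (toℕ i ≤? m) (toℕ j ≤? m)
         (%-≡⇒≈ (value (toℕ i)) (value (toℕ j))
           (trans (sym (toℕ-fromℕ< (n%ℕd<d (value (toℕ i)) p))) (trans (cong toℕ same) (toℕ-fromℕ< (n%ℕd<d (value (toℕ j)) p)))))
    where
    value : ℕ → ℤ
    value i = candidate t i (i ≤? m)
    residue-of : Fin (suc p) → Fin p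
    residue-of i = fromℕ< (n%ℕd<d (value (toℕ i)) p)

module DiamondScaling (p : ℕ) {{_ : NonZero p}} (prime : Prime p) (m : ℕ) (p≡2m+1 : p ≡ suc (m Nat.+ m))
                      (c : ℕ) (c<p : c < p) (c≢0 : c ≢ 0) where
  open Int using (_+_; _*_)
  open ModularArithmetic p prime
  open Collineations p prime
  open Conics p prime c
  open NormForm p prime m p≡2m+1 c c<p c≢0

  -- If k′ l ≈ k l′ with k, k′ nonzero, then O_k ⋄ O_l implies O_k′ ⋄ O_l′: writing k′/k = a² + c b²,
  -- the rotation by a + b√−c carries O_k′ onto O_k and O_l′ onto O_l.
  diamond-proportional : ∀ {k l k′ l′} → + k ≉ + 0 → + k′ ≉ + 0 → + k′ * + l ≈ + k * + l′ →
                         Diamond p c k l → Diamond p c k′ l′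
  diamond-proportional {k} {l} {k′} {l′} k≉0 k′≉0 k′l≈kl′ = transfer (normForm-surjective r)
    where
    k⁻¹ : ℤ
    k⁻¹ = inv (+ k) k≉0
    kk⁻¹≈1 : + k * k⁻¹ ≈ + 1
    kk⁻¹≈1 = inv-spec (+ k) k≉0
    r : ℤ
    r = + k′ * k⁻¹
    r≉0 : r ≉ + 0
    r≉0 = *-≉0 k′≉0 (unit-≉0 (+ k) kk⁻¹≈1)
    open ≈-Reasoning
    k′≈kr : + k′ ≈ + k * r
    k′≈kr = begin
      + k′               ≡⟨ IntP.*-identityʳ (+ k′) ⟨
      + k′ * + 1         ≈⟨ *-congˡ (+ k′) (≈-sym kk⁻¹≈1) ⟩
      + k′ * (+ k * k⁻¹) ≡⟨ lemma (+ k′) (+ k) k⁻¹ ⟩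
      + k * r            ∎
      where lemma : ∀ k′ k i → k′ * (k * i) ≡ k * (k′ * i)
            lemma = solve-∀
    l′≈lr : + l′ ≈ + l * r
    l′≈lr = begin
      + l′                 ≡⟨ IntP.*-identityʳ (+ l′) ⟨
      + l′ * + 1           ≈⟨ *-congˡ (+ l′) (≈-sym kk⁻¹≈1) ⟩
      + l′ * (+ k * k⁻¹)   ≡⟨ lemma (+ l′) (+ k) k⁻¹ ⟩
      + k * + l′ * k⁻¹     ≈⟨ *-congʳ k⁻¹ (≈-sym k′l≈kl′) ⟩
      + k′ * + l * k⁻¹     ≡⟨ lemma′ (+ k′) (+ l) k⁻¹ ⟩
      + l * r              ∎
      where lemma : ∀ l′ k i → l′ * (k * i) ≡ k * l′ * i
            lemma = solve-∀
            lemma′ : ∀ k′ l i → k′ * l * i ≡ l * (k′ * i)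
            lemma′ = solve-∀
    transfer : (∃₂ λ a b → normForm a b ≈ r) → Diamond p c k l → Diamond p c k′ l′
    transfer (a , b , N≈r) = diamond-transfer {M = rotation a b}
      (invertible (subst (_≉ + 0) (sym (det-rotation a b)) (λ N≈0 → r≉0 (≈-trans (≈-sym N≈r) N≈0))))
      (rotation-carries a b (≈-trans k′≈kr (*-congˡ (+ k) (≈-sym N≈r))))
      (rotation-carries a b (≈-trans l′≈lr (*-congˡ (+ l) (≈-sym N≈r))))

odd⇒2m+1 : ∀ p → p Nat.% 2 ≡ 1 → p ≡ suc (p Nat./ 2 Nat.+ p Nat./ 2)
odd⇒2m+1 p p%2≡1 = begin
  p                               ≡⟨ NatDM.m≡m%n+[m/n]*n p 2 ⟩
  p Nat.% 2 Nat.+ p Nat./ 2 Nat.* 2 ≡⟨ cong (Nat._+ p Nat./ 2 Nat.* 2) p%2≡1 ⟩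
  suc (p Nat./ 2 Nat.* 2)          ≡⟨ cong suc (NatP.*-comm (p Nat./ 2) 2) ⟩
  suc (p Nat./ 2 Nat.+ (p Nat./ 2 Nat.+ 0)) ≡⟨ cong (λ t → suc (p Nat./ 2 Nat.+ t)) (NatP.+-identityʳ (p Nat./ 2)) ⟩
  suc (p Nat./ 2 Nat.+ p Nat./ 2) ∎
  where open ≡-Reasoning

open import Data.Nat using (_*_)

mainTheorem6 : (p : ℕ) .{{_ : NonZero p}} → Prime p → p % 2 ≡ 1 →
    (c : ℕ) → c < p → c ≢ 0 →
    (p % 4 ≡ 1 → ¬ IsSquare p c) → (p % 4 ≡ 3 → IsSquare p c) →
    (α β γ : ℕ) → α < p → α ≢ 0 → β < p → β ≢ 0 → γ < p →
    (γ * α) % p ≡ (β * β) % p →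
    (Diamond p c α β ⇔ Diamond p c β γ)
mainTheorem6 p p-prime p-odd c c<p c≢0 _ _ α β γ α<p α≢0 β<p β≢0 _ γα≡ββ =
  mk⇔ (diamond-proportional α≉0 β≉0 ββ≈αγ) (diamond-proportional β≉0 α≉0 (≈-sym ββ≈αγ))
  where
  p≢0 : NonZero p
  p≢0 = prime⇒nonZero p-prime
  open ModularArithmetic p {{p≢0}} p-prime
  open DiamondScaling p {{p≢0}} p-prime (p Nat./ 2) (odd⇒2m+1 p p-odd) c c<p c≢0
  α≉0 : + α ≉ + 0
  α≉0 = small≉0 α≢0 α<p
  β≉0 : + β ≉ + 0
  β≉0 = small≉0 β≢0 β<p
  ββ≈αγ : + β Int.* + β ≈ + α Int.* + γ
  ββ≈αγ = begin
    + β Int.* + β   ≡⟨ IntP.pos-* β β ⟨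
    + (β * β)       ≈⟨ %-≡⇒≈ (+ (β * β)) (+ (γ * α)) (sym γα≡ββ) ⟩
    + (γ * α)       ≡⟨ IntP.pos-* γ α ⟩
    + γ Int.* + α   ≡⟨ IntP.*-comm (+ γ) (+ α) ⟩
    + α Int.* + γ   ∎
    where open ≈-Reasoning
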